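{- For any integer $r\ge 2$ and any positive integer $k$, there exists an integer $n$ such that $\chi(H_{n:r})=k$.
   Context: For positive integers $n,r$ write $[n]=\{1,\dots,n\}$. The Häggkvist–Hell graph $H_{n:r}$ is the graph whose vertices are the ordered pairs $(h,T)$ where $T$ is an $r$-element subset of $[n]$ and $h\in[n]\setminus T$; two vertices $(h_x,T_x)$ and $(h_y,T_y)$ are adjacent iff $h_x\in T_y$, $h_y\in T_x$ and $T_x\cap T_y=\varnothing$. $\chi$ denotes chromatic number. -}

module Defs where

open import Data.Nat using (ℕ; _<_)
open import Data.Fin using (Fin)
open import Data.Fin.Subset using (Subset; _∈_; _∉_; _∩_; ∣_∣; Empty)
open import Data.Product using (Σ; _×_; _,_; proj₁; proj₂)
open import Relation.Binary.PropositionalEquality using (_≡_; _≢_)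
open import Relation.Nullary using (¬_)

record Graph : Set₁ where
  field
    V   : Set
    Adj : V → V → Set
open Graph public

HHVertex : ℕ → ℕ → Set
HHVertex n r = Σ (Fin n × Subset n) λ p → (∣ proj₂ p ∣ ≡ r) × (proj₁ p ∉ proj₂ p)

head : ∀ {n r} → HHVertex n r → Fin n
head v = proj₁ (proj₁ v)

tail : ∀ {n r} → HHVertex n r → Subset n
tail v = proj₂ (proj₁ v)

HH : ℕ → ℕ → Graph
HH n r = record
  { V   = HHVertex n r
  ; Adj = λ x y → (head x ∈ tail y) × (head y ∈ tail x) × Empty (tail x ∩ tail y)
  }

Colouring : Graph → ℕ → Set
Colouring G k = Σ (V G → Fin k) λ c → ∀ x y → Adj G x y → c x ≢ c y

Colourable : Graph → ℕ → Set
Colourable G k = Colouring G k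

ChromaticNumber≡ : Graph → ℕ → Set
ChromaticNumber≡ G k = Colourable G k × (∀ m → m < k → ¬ Colourable G m)

module Submission where

-- The proof is a discrete intermediate value argument in n, for k = j + 1:
--   * χ(H_{0:r}) = 0, since H_{0:r} has no vertices;
--   * χ(H_{n+1:r}) ≤ χ(H_{n:r}) + 1 (lemma 'growth');
--   * χ(H_{n:r}) is unbounded: a colouring of H_{m(r-1):r} induces a colouring of the
--     3-uniform shift graph on m points, whose chromatic number grows like log log m
--     (lemmas 'no-shiftColouring₃' and 'Embedding.HH-not-colourable');
--   * j-colourability of H_{n:r} is decidable, since H_{n:r} is a finite graph
--     (lemma 'HH-colourable?', built on finite retracts of 'Fin N').

open import Defs
open import Data.Bool using (Bool; true; false; T)
open import Data.Nat using (ℕ; zero; suc; _+_; _*_; _^_; _≤_; s≤s; s≤s⁻¹)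
import Data.Nat as ℕ
open import Data.Nat.Properties using (+-identityʳ; n<1+n)
open import Data.Fin using (Fin; zero; suc; _↑ˡ_; _↑ʳ_; combine; remQuot; quotient; inject≤; _<_; _<?_)
open import Data.Fin.Properties
  using (¬Fin0; _≟_; any?; all?; pigeonhole; inject≤-injective; suc-injective;
         remQuot-combine; combine-remQuot; combine-injectiveˡ; <-irrelevant; <-irrefl; <-trans; <⇒≢)
open import Data.Fin.Subset
  using (Subset; inside; outside; _∈_; _∉_; _∩_; _∪_; ⁅_⁆; ∣_∣; Nonempty; Empty; ⊤; ⊥)
open import Data.Fin.Subset.Properties
  using (_∈?_; nonempty?; Empty-unique; ∣⊥∣≡0; ∣⊤∣≡n; ∈⊤; ∉⊥; x∈⁅x⁆; x∈⁅y⁆⇒x≡y;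
         x∈p∪q⁺; x∈p∪q⁻; x∈p∩q⁺; x∈p∩q⁻; ∪-identityˡ)
open import Data.Vec using (Vec; []; _∷_; _++_; lookup; tabulate; here; there)
open import Data.Vec.Properties using (lookup∘tabulate; []=⇒lookup; lookup⇒[]=; lookup-++ˡ; lookup-++ʳ)
open import Data.Product using (Σ; ∃; _×_; _,_; proj₁)
import Data.Product as Product
open import Data.Sum using (_⊎_; inj₁; inj₂; [_,_])
open import Function using (id; _∘_)
open import Relation.Nullary using (¬_; Dec; yes; no; does; contradiction)
open import Relation.Nullary.Decidable using (map′; _×-dec_; _→-dec_; ¬?; dec-true; isYes≗does; toWitness)
open import Relation.Binary.PropositionalEquality
  using (_≡_; _≢_; refl; sym; trans; cong; cong₂; subst; subst₂; module ≡-Reasoning)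

open ≡-Reasoning

colourable-mono : ∀ {G m k} → m ≤ k → Colourable G m → Colourable G k
colourable-mono m≤k (c , proper) =
  (λ v → inject≤ (c v) m≤k) , λ x y xy eq → proper x y xy (inject≤-injective m≤k m≤k _ _ eq)

-- A retract of Fin N: the type is "finite of size at most N" in a computable way.
record Retract (A : Set) (N : ℕ) : Set where
  field
    encode        : A → Fin N
    decode        : Fin N → A
    decode-encode : ∀ a → decode (encode a) ≡ a

  encode-injective : ∀ {a b} → encode a ≡ encode b → a ≡ b
  encode-injective {a} {b} eq = begin
    a                 ≡⟨ sym (decode-encode a) ⟩
    decode (encode a) ≡⟨ cong decode eq ⟩
    decode (encode b) ≡⟨ decode-encode b ⟩
    b                 ∎

  search : {P : A → Set} → (∀ a → Dec (P a)) → Dec (∃ P)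
  search {P} P? = map′ (λ (i , p) → decode i , p)
                       (λ (a , p) → encode a , subst P (sym (decode-encode a)) p)
                       (any? (P? ∘ decode))

open Retract using (encode; decode; decode-encode)

Fin-retract : ∀ {n} → Retract (Fin n) n
Fin-retract .encode        = id
Fin-retract .decode        = id
Fin-retract .decode-encode _ = refl

Bool-retract : Retract Bool 2
Bool-retract .encode false = zero
Bool-retract .encode true  = suc zero
Bool-retract .decode zero    = false
Bool-retract .decode (suc _) = true
Bool-retract .decode-encode false = refl
Bool-retract .decode-encode true  = refl

×-retract : ∀ {A B m n} → Retract A m → Retract B n → Retract (A × B) (m * n)
×-retract ρ σ .encode (a , b) = combine (ρ .encode a) (σ .encode b)
×-retract {n = n} ρ σ .decode i = Product.map (ρ .decode) (σ .decode) (remQuot n i)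
×-retract {n = n} ρ σ .decode-encode (a , b) = begin
  Product.map (ρ .decode) (σ .decode) (remQuot n (combine (ρ .encode a) (σ .encode b)))
    ≡⟨ cong (Product.map (ρ .decode) (σ .decode)) (remQuot-combine (ρ .encode a) (σ .encode b)) ⟩
  (ρ .decode (ρ .encode a) , σ .decode (σ .encode b))
    ≡⟨ cong₂ _,_ (ρ .decode-encode a) (σ .decode-encode b) ⟩
  (a , b) ∎

retract-via : ∀ {A B N} → Retract A N → (f : A → B) (g : B → A) → (∀ b → f (g b) ≡ b) → Retract B N
retract-via ρ f g fg .encode = ρ .encode ∘ g
retract-via ρ f g fg .decode = f ∘ ρ .decode
retract-via ρ f g fg .decode-encode b = trans (cong f (ρ .decode-encode (g b))) (fg b)

Vec-retract : ∀ {A m} → Retract A m → ∀ n → Retract (Vec A n) (m ^ n)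
Vec-retract ρ zero .encode _ = zero
Vec-retract ρ zero .decode _ = []
Vec-retract ρ zero .decode-encode [] = refl
Vec-retract ρ (suc n) =
  retract-via (×-retract ρ (Vec-retract ρ n))
              (λ (x , xs) → x ∷ xs) (λ { (x ∷ xs) → x , xs }) λ { (_ ∷ _) → refl }

Subset-retract : ∀ K → Retract (Subset K) (2 ^ K)
Subset-retract = Vec-retract Bool-retract

KeyGraph : (K : Set) → (K → Set) → (K → K → Set) → Graph
KeyGraph K P R = record { V = Σ K P ; Adj = λ x y → R (proj₁ x) (proj₁ y) }

-- For keys forming a retract of Fin N, with P and R decidable, colourability is decidable:
-- a k-colouring (k ≥ 1) is the same as a proper colour table indexed by the codes.
module _ {K : Set} {N : ℕ} {P : K → Set} {R : K → K → Set}
         (ρ : Retract K N) (P? : ∀ a → Dec (P a)) (R? : ∀ a b → Dec (R a b)) where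

  private
    G : Graph
    G = KeyGraph K P R

  ProperTable : ∀ {k} → Vec (Fin k) N → Set
  ProperTable t = ∀ i j → P (ρ .decode i) → P (ρ .decode j) → R (ρ .decode i) (ρ .decode j) →
                  lookup t i ≢ lookup t j

  properTable? : ∀ {k} (t : Vec (Fin k) N) → Dec (ProperTable t)
  properTable? t = all? λ i → all? λ j →
    P? _ →-dec (P? _ →-dec (R? _ _ →-dec ¬? (lookup t i ≟ lookup t j)))

  tableColouring : ∀ {k} (t : Vec (Fin k) N) → ProperTable t → Colourable G k
  tableColouring t proper =
    (λ v → lookup t (ρ .encode (proj₁ v))) ,
    λ (a , p) (b , q) ab → proper _ _ (valid p) (valid q)
                             (subst₂ R (sym (ρ .decode-encode a)) (sym (ρ .decode-encode b)) ab)
    where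
    valid : ∀ {a} → P a → P (ρ .decode (ρ .encode a))
    valid {a} = subst P (sym (ρ .decode-encode a))

  colourOf : ∀ {k} → Colourable G (suc k) → (a : K) → Dec (P a) → Fin (suc k)
  colourOf (c , _) a (yes p) = c (a , p)
  colourOf _       a (no _)  = zero

  colourOf-proper : ∀ {k} (col : Colourable G (suc k)) {a b} (a? : Dec (P a)) (b? : Dec (P b)) →
                    P a → P b → R a b → colourOf col a a? ≢ colourOf col b b?
  colourOf-proper (_ , proper) (yes p) (yes q) _ _ ab = proper (_ , p) (_ , q) ab
  colourOf-proper _            (no ¬p) _       p _ _  = contradiction p ¬p
  colourOf-proper _            (yes _) (no ¬q) _ q _  = contradiction q ¬q

  colouringTable : ∀ {k} → Colourable G (suc k) → ∃ (ProperTable {suc k})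
  colouringTable {k} col = tabulate entry , λ i j pi pj ij eq →
    colourOf-proper col (P? (ρ .decode i)) (P? (ρ .decode j)) pi pj ij
      (trans (sym (lookup∘tabulate entry i)) (trans eq (lookup∘tabulate entry j)))
    where
    entry : Fin N → Fin (suc k)
    entry i = colourOf col (ρ .decode i) (P? (ρ .decode i))

  colourable? : ∀ k → Dec (Colourable G k)
  colourable? zero = map′ emptyColouring (λ (c , _) (a , p) → ¬Fin0 (c (a , p))) (¬? (Retract.search ρ P?))
    where
    emptyColouring : ¬ ∃ P → Colourable G 0
    emptyColouring none = (λ v → contradiction v none) , λ x → contradiction x none
  colourable? (suc k) = map′ (λ (t , proper) → tableColouring t proper) colouringTable
                             (Retract.search (Vec-retract Fin-retract N) properTable?)

HHValid : ∀ {n} → ℕ → Fin n × Subset n → Set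
HHValid r (h , T) = (∣ T ∣ ≡ r) × (h ∉ T)

HHAdj : ∀ {n} → Fin n × Subset n → Fin n × Subset n → Set
HHAdj (h , S) (h′ , T) = (h ∈ T) × (h′ ∈ S) × Empty (S ∩ T)

HH-colourable? : ∀ n r k → Dec (Colourable (HH n r) k)
HH-colourable? n r =
  colourable? {P = HHValid r} {R = HHAdj} (×-retract Fin-retract (Subset-retract n)) valid? adjacent?
  where
  valid? : ∀ a → Dec (HHValid r a)
  valid? (h , T) = (∣ T ∣ ℕ.≟ r) ×-dec ¬? (h ∈? T)
  adjacent? : ∀ a b → Dec (HHAdj a b)
  adjacent? (h , S) (h′ , T) = (h ∈? T) ×-dec (h′ ∈? S) ×-dec ¬? (nonempty? (S ∩ T))

HH₀-colourable : ∀ r k → Colourable (HH 0 r) k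
HH₀-colourable r k = (λ { ((() , _) , _) }) , λ { ((() , _) , _) }

threshold : {P : ℕ → Set} → (∀ n → Dec (P n)) → P 0 → ∀ N → ¬ P N → ∃ λ n → P n × ¬ P (suc n)
threshold P? p₀ zero    ¬p₀ = contradiction p₀ ¬p₀
threshold P? p₀ (suc N) ¬pN+1 with P? N
... | yes pN = N , pN , ¬pN+1
... | no ¬pN = threshold P? p₀ N ¬pN

drop0 : ∀ {n r} {h : Fin n} {T : Subset n} → HHValid r (suc h , outside ∷ T) → HHValid r (h , T)
drop0 (size , h∉T) = size , h∉T ∘ there

positive⇒nonempty : ∀ {n} (T : Subset n) → 1 ≤ ∣ T ∣ → Nonempty T
positive⇒nonempty {n} T 1≤∣T∣ with nonempty? T
... | yes nonempty = nonempty
... | no empty     = contradiction (subst (1 ≤_) size≡0 1≤∣T∣) λ ()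
  where
  size≡0 : ∣ T ∣ ≡ 0
  size≡0 = trans (cong ∣_∣ (Empty-unique empty)) (∣⊥∣≡0 n)

borrowHead : ∀ {n r} {S T : Subset n} → 2 ≤ r → ∣ S ∣ ≡ r → suc ∣ T ∣ ≡ r → (∀ {e} → e ∈ T → e ∉ S) →
             HHVertex n r
borrowHead {T = T} 2≤r sizeS sizeT disjoint =
  let (e , e∈T) = positive⇒nonempty T (s≤s⁻¹ (subst (2 ≤_) (sym sizeT) 2≤r))
  in (e , _) , sizeS , disjoint e∈T

-- For r ≥ 2, an edge of H_{n+1:r} yields a vertex of H_{n:r}: either a tail contains 0 and
-- lends one of its other points as a head for the other tail, or an endpoint avoids 0.
edge⇒vertex : ∀ {n r} → 2 ≤ r → (x y : HHVertex (suc n) r) → Adj (HH (suc n) r) x y → HHVertex n r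
edge⇒vertex _ ((_ , inside ∷ _) , _) ((_ , inside ∷ _) , _) (_ , _ , disjoint) =
  contradiction (zero , here) disjoint
edge⇒vertex 2≤r ((_ , inside ∷ S) , sizeS , _) ((_ , outside ∷ T) , sizeT , _) (_ , _ , disjoint) =
  borrowHead 2≤r sizeT sizeS λ e∈S e∈T → disjoint (suc _ , there (x∈p∩q⁺ (e∈S , e∈T)))
edge⇒vertex 2≤r ((_ , outside ∷ S) , sizeS , _) ((_ , inside ∷ T) , sizeT , _) (_ , _ , disjoint) =
  borrowHead 2≤r sizeS sizeT λ e∈T e∈S → disjoint (suc _ , there (x∈p∩q⁺ (e∈S , e∈T)))
edge⇒vertex _ ((suc h , outside ∷ S) , valid) ((_ , outside ∷ _) , _) _ = (h , S) , drop0 valid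
edge⇒vertex _ ((zero , outside ∷ _) , _) ((_ , outside ∷ _) , _) (() , _ , _)

-- χ(H_{n+1:r}) ≤ χ(H_{n:r}) + 1.  Vertices whose tail contains 0 are pairwise non-adjacent
-- and share the new colour 0; vertices with head 0 are adjacent only to those and take
-- colour 1; the remaining vertices form a copy of H_{n:r}.  With no colours for H_{n:r},
-- H_{n+1:r} has no edges at all.
growth : ∀ {n r k} → 2 ≤ r → Colourable (HH n r) k → Colourable (HH (suc n) r) (suc k)
growth {k = zero} 2≤r (c , _) = (λ _ → zero) , λ x y xy _ → ¬Fin0 (c (edge⇒vertex 2≤r x y xy))
growth {n} {r} {suc k} _ (c , proper) = colour , colour-proper
  where
  colour : HHVertex (suc n) r → Fin (suc (suc k))
  colour ((_ , inside ∷ _) , _)             = zero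
  colour ((zero , outside ∷ _) , _)         = suc zero
  colour ((suc h , outside ∷ T) , valid)    = suc (c ((h , T) , drop0 valid))

  colour-proper : ∀ x y → Adj (HH (suc n) r) x y → colour x ≢ colour y
  colour-proper ((_ , inside ∷ _) , _) ((_ , inside ∷ _) , _) (_ , _ , disjoint) =
    contradiction (zero , here) disjoint
  colour-proper ((_ , inside ∷ _) , _) ((zero , outside ∷ _) , _) _ = λ ()
  colour-proper ((_ , inside ∷ _) , _) ((suc _ , outside ∷ _) , _) _ = λ ()
  colour-proper ((zero , outside ∷ _) , _) ((_ , inside ∷ _) , _) _ = λ ()
  colour-proper ((suc _ , outside ∷ _) , _) ((_ , inside ∷ _) , _) _ = λ ()
  colour-proper ((zero , outside ∷ _) , _) ((_ , outside ∷ _) , _) (() , _ , _)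
  colour-proper ((suc _ , outside ∷ _) , _) ((zero , outside ∷ _) , _) (_ , () , _)
  colour-proper ((suc _ , outside ∷ _) , vx) ((suc _ , outside ∷ _) , vy)
                (there hx∈Ty , there hy∈Tx , disjoint) =
    proper (_ , drop0 vx) (_ , drop0 vy) (hx∈Ty , hy∈Tx , λ (e , e∈) → disjoint (suc e , there e∈))
    ∘ suc-injective

characteristic-⇒ : ∀ {K} {P Q : Fin K → Set} (P? : ∀ i → Dec (P i)) (Q? : ∀ i → Dec (Q i)) →
                   tabulate (does ∘ P?) ≡ tabulate (does ∘ Q?) → ∀ {i} → P i → Q i
characteristic-⇒ P? Q? eq {i} p = toWitness {a? = Q? i} (subst T (sym (trans (isYes≗does (Q? i)) Q-holds)) _)
  where
  Q-holds : does (Q? i) ≡ true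
  Q-holds = begin
    does (Q? i)                     ≡⟨ sym (lookup∘tabulate (does ∘ Q?) i) ⟩
    lookup (tabulate (does ∘ Q?)) i ≡⟨ cong (λ v → lookup v i) (sym eq) ⟩
    lookup (tabulate (does ∘ P?)) i ≡⟨ lookup∘tabulate (does ∘ P?) i ⟩
    does (P? i)                     ≡⟨ dec-true (P? i) p ⟩
    true                            ∎

-- Colourings of the shift graphs on Fin m: S(m,2) has vertices a < b with (a,b) ~ (b,c),
-- S(m,3) has vertices a < b < c with (a,b,c) ~ (b,c,d).
ShiftColouring₂ : ℕ → ℕ → Set
ShiftColouring₂ m K = Σ ((a b : Fin m) → a < b → Fin K) λ f →
  ∀ a b c (a<b : a < b) (b<c : b < c) → f a b a<b ≢ f b c b<c

ShiftColouring₃ : ℕ → ℕ → Set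
ShiftColouring₃ m K = Σ ((a b c : Fin m) → a < b → b < c → Fin K) λ g →
  ∀ a b c d (a<b : a < b) (b<c : b < c) (c<d : c < d) → g a b c a<b b<c ≢ g b c d b<c c<d

Uses : ∀ {m K} (b : Fin m) → ((x : Fin m) → b < x → Fin K) → Fin K → Set
Uses b h i = ∃ λ x → Σ (b < x) λ b<x → h x b<x ≡ i

uses? : ∀ {m K} (b : Fin m) (h : (x : Fin m) → b < x → Fin K) i → Dec (Uses b h i)
uses? b h i = any? usedAt
  where
  usedAt : ∀ x → Dec (Σ (b < x) λ b<x → h x b<x ≡ i)
  usedAt x with b <? x
  ... | yes b<x = map′ (b<x ,_) (λ (b<x′ , eq) → trans (cong (h x) (<-irrelevant b<x b<x′)) eq)
                       (h x b<x ≟ i)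
  ... | no b≮x  = no (b≮x ∘ proj₁)

palette : ∀ {m K} (b : Fin m) → ((x : Fin m) → b < x → Fin K) → Subset K
palette b h = tabulate (does ∘ uses? b h)

palette-≡ : ∀ {m K} {b c : Fin m} {h : (x : Fin m) → b < x → Fin K} {h′ : (x : Fin m) → c < x → Fin K} →
            palette b h ≡ palette c h′ → ∀ {i} → Uses b h i → Uses c h′ i
palette-≡ {b = b} {c} {h} {h′} = characteristic-⇒ (uses? b h) (uses? c h′)

-- S(m,2) is not K-colourable when 2^K < m: two points b < b′ have the same palette by
-- pigeonhole, and the colour of (b , b′) is then reused on some (b′ , x).
no-shiftColouring₂ : ∀ {m K} → 2 ^ K ℕ.< m → ¬ ShiftColouring₂ m K
no-shiftColouring₂ {K = K} 2^K<m (f , proper) =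
  let (b , b′ , b<b′ , same) = pigeonhole 2^K<m (λ b → Subset-retract K .encode (palette b (f b)))
      (x , b′<x , reused)    =
        palette-≡ (Retract.encode-injective (Subset-retract K) same) (b′ , b<b′ , refl)
  in proper b b′ x b<b′ b′<x (sym reused)

-- A k-colouring g of S(m,3) gives a 2^k-colouring of S(m,2): colour (a , b) by the palette
-- of the colours g a b x, b < x.
shift₃⇒shift₂ : ∀ {m k} → ShiftColouring₃ m k → ShiftColouring₂ m (2 ^ k)
shift₃⇒shift₂ {k = k} (g , proper) =
  (λ a b a<b → Subset-retract k .encode (palette b λ x b<x → g a b x a<b b<x)) ,
  λ a b c a<b b<c same →
    let (x , c<x , reused) =
          palette-≡ (Retract.encode-injective (Subset-retract k) same) (c , b<c , refl)
    in proper a b c x a<b b<c c<x (sym reused)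

no-shiftColouring₃ : ∀ {m k} → 2 ^ 2 ^ k ℕ.< m → ¬ ShiftColouring₃ m k
no-shiftColouring₃ 2^2^k<m = no-shiftColouring₂ 2^2^k<m ∘ shift₃⇒shift₂

∣++∣ : ∀ {m n} (p : Subset m) (q : Subset n) → ∣ p ++ q ∣ ≡ ∣ p ∣ + ∣ q ∣
∣++∣ []            q = refl
∣++∣ (inside ∷ p)  q = cong suc (∣++∣ p q)
∣++∣ (outside ∷ p) q = ∣++∣ p q

∈-by-lookup : ∀ {m n} {p : Subset m} {q : Subset n} {x y} → lookup p x ≡ lookup q y → x ∈ p → y ∈ q
∈-by-lookup {q = q} {y = y} eq x∈p = lookup⇒[]= y q (trans (sym eq) ([]=⇒lookup x∈p))

∈-++⁺ˡ : ∀ {m n} (p : Subset m) (q : Subset n) {x} → x ∈ p → x ↑ˡ n ∈ p ++ q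
∈-++⁺ˡ p q {x} = ∈-by-lookup (sym (lookup-++ˡ p q x))

∈-++⁻ˡ : ∀ {m n} (p : Subset m) (q : Subset n) {x} → x ↑ˡ n ∈ p ++ q → x ∈ p
∈-++⁻ˡ p q {x} = ∈-by-lookup (lookup-++ˡ p q x)

∈-++⁺ʳ : ∀ {m n} (p : Subset m) (q : Subset n) {x} → x ∈ q → m ↑ʳ x ∈ p ++ q
∈-++⁺ʳ p q {x} = ∈-by-lookup (sym (lookup-++ʳ p q x))

∈-++⁻ʳ : ∀ {m n} (p : Subset m) (q : Subset n) {x} → m ↑ʳ x ∈ p ++ q → x ∈ q
∈-++⁻ʳ p q {x} = ∈-by-lookup (lookup-++ʳ p q x)

∣⁅x⁆∪p∣ : ∀ {n} (x : Fin n) (p : Subset n) → x ∉ p → ∣ ⁅ x ⁆ ∪ p ∣ ≡ suc ∣ p ∣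
∣⁅x⁆∪p∣ zero    (inside ∷ p)  x∉p = contradiction here x∉p
∣⁅x⁆∪p∣ zero    (outside ∷ p) _   = cong (suc ∘ ∣_∣) (∪-identityˡ p)
∣⁅x⁆∪p∣ (suc x) (inside ∷ p)  x∉p = cong suc (∣⁅x⁆∪p∣ x p (x∉p ∘ there))
∣⁅x⁆∪p∣ (suc x) (outside ∷ p) x∉p = ∣⁅x⁆∪p∣ x p (x∉p ∘ there)

-- The ground set Fin (m * s) is cut into m blocks
-- of size s; the triple a < h < b becomes the vertex with head the first point of block h
-- and tail {first point of block a} ∪ block b.
module Embedding (t : ℕ) where

  s : ℕ
  s = suc t

  Block : ∀ {m} → Fin m → Subset (m * s)
  Block {suc m} zero    = ⊤ {s} ++ ⊥ {m * s}
  Block {suc m} (suc b) = ⊥ {s} ++ Block b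

  ∣Block∣ : ∀ {m} (b : Fin m) → ∣ Block b ∣ ≡ s
  ∣Block∣ {suc m} zero = begin
    ∣ ⊤ {s} ++ ⊥ {m * s} ∣ ≡⟨ ∣++∣ (⊤ {s}) (⊥ {m * s}) ⟩
    ∣ ⊤ {s} ∣ + ∣ ⊥ {m * s} ∣ ≡⟨ cong₂ _+_ (∣⊤∣≡n s) (∣⊥∣≡0 (m * s)) ⟩
    s + 0                 ≡⟨ +-identityʳ s ⟩
    s                     ∎
  ∣Block∣ {suc m} (suc b) = begin
    ∣ ⊥ {s} ++ Block b ∣  ≡⟨ ∣++∣ (⊥ {s}) (Block b) ⟩
    ∣ ⊥ {s} ∣ + ∣ Block b ∣ ≡⟨ cong₂ _+_ (∣⊥∣≡0 s) (∣Block∣ b) ⟩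
    s                     ∎

  ∈Block : ∀ {m} (b : Fin m) o → combine b o ∈ Block b
  ∈Block {suc m} zero    o = ∈-++⁺ˡ (⊤ {s}) (⊥ {m * s}) ∈⊤
  ∈Block {suc m} (suc b) o = ∈-++⁺ʳ (⊥ {s}) (Block b) (∈Block b o)

  ∈Block⁻ : ∀ {m} (i b : Fin m) o → combine i o ∈ Block b → i ≡ b
  ∈Block⁻ {suc m} zero    zero    _ _   = refl
  ∈Block⁻ {suc m} zero    (suc b) _ mem = contradiction (∈-++⁻ˡ (⊥ {s}) (Block b) mem) ∉⊥
  ∈Block⁻ {suc m} (suc i) zero    _ mem = contradiction (∈-++⁻ʳ (⊤ {s}) (⊥ {m * s}) mem) ∉⊥
  ∈Block⁻ {suc m} (suc i) (suc b) o mem = cong suc (∈Block⁻ i b o (∈-++⁻ʳ (⊥ {s}) (Block b) mem))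

  first : ∀ {m} → Fin m → Fin (m * s)
  first a = combine a zero

  tailSet : ∀ {m} → Fin m → Fin m → Subset (m * s)
  tailSet a b = ⁅ first a ⁆ ∪ Block b

  ∈tailSet⁻ : ∀ {m} {a b : Fin m} i o → combine i o ∈ tailSet a b → i ≡ a ⊎ i ≡ b
  ∈tailSet⁻ {a = a} {b} i o mem with x∈p∪q⁻ ⁅ first a ⁆ (Block b) mem
  ... | inj₁ inFirst = inj₁ (combine-injectiveˡ i o a zero (x∈⁅y⁆⇒x≡y (first a) inFirst))
  ... | inj₂ inBlock = inj₂ (∈Block⁻ i b o inBlock)

  ∈tailSet⁻′ : ∀ {m} {a b : Fin m} {e} → e ∈ tailSet a b → quotient s e ≡ a ⊎ quotient s e ≡ b
  ∈tailSet⁻′ {m} {a} {b} {e} mem =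
    ∈tailSet⁻ _ _ (subst (_∈ tailSet a b) (sym (combine-remQuot {m} s e)) mem)

  separated : ∀ {m} {a h b c x : Fin m} → a < h → h < b → b < c → x ≡ a ⊎ x ≡ b → ¬ (x ≡ h ⊎ x ≡ c)
  separated a<h _   _   (inj₁ refl) (inj₁ refl) = <-irrefl refl a<h
  separated a<h h<b b<c (inj₁ refl) (inj₂ refl) = <-irrefl refl (<-trans a<h (<-trans h<b b<c))
  separated _   h<b _   (inj₂ refl) (inj₁ refl) = <-irrefl refl h<b
  separated _   _   b<c (inj₂ refl) (inj₂ refl) = <-irrefl refl b<c

  vertex : ∀ {m} (a h b : Fin m) → a < h → h < b → HHVertex (m * s) (suc s)
  vertex a h b a<h h<b = (first h , tailSet a b) , size , head∉tail
    where
    size : ∣ tailSet a b ∣ ≡ suc s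
    size = trans (∣⁅x⁆∪p∣ (first a) (Block b) (<⇒≢ (<-trans a<h h<b) ∘ ∈Block⁻ a b zero))
                 (cong suc (∣Block∣ b))
    head∉tail : first h ∉ tailSet a b
    head∉tail = [ <⇒≢ a<h ∘ sym , <⇒≢ h<b ] ∘ ∈tailSet⁻ h zero

  vertex-adjacent : ∀ {m} (a h b c : Fin m) (a<h : a < h) (h<b : h < b) (b<c : b < c) →
                    Adj (HH (m * s) (suc s)) (vertex a h b a<h h<b) (vertex h b c h<b b<c)
  vertex-adjacent a h b c a<h h<b b<c =
    x∈p∪q⁺ (inj₁ (x∈⁅x⁆ (first h))) , x∈p∪q⁺ (inj₂ (∈Block b zero)) , disjoint
    where
    disjoint : Empty (tailSet a b ∩ tailSet h c)
    disjoint (e , mem) =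
      let (in-ab , in-hc) = x∈p∩q⁻ (tailSet a b) (tailSet h c) mem
      in separated a<h h<b b<c (∈tailSet⁻′ in-ab) (∈tailSet⁻′ in-hc)

  shiftColouring : ∀ {m k} → Colourable (HH (m * s) (suc s)) k → ShiftColouring₃ m k
  shiftColouring (col , proper) =
    (λ a h b a<h h<b → col (vertex a h b a<h h<b)) ,
    λ a h b c a<h h<b b<c → proper _ _ (vertex-adjacent a h b c a<h h<b b<c)

  HH-not-colourable : ∀ {m k} → 2 ^ 2 ^ k ℕ.< m → ¬ Colourable (HH (m * s) (suc s)) k
  HH-not-colourable 2^2^k<m = no-shiftColouring₃ 2^2^k<m ∘ shiftColouring

-- For k = j + 1: H_{0:r} is j-colourable and H_{m(r-1):r} is not, for m = 2^(2^j) + 1;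
-- at the last n where H_{n:r} is j-colourable, χ(H_{n+1:r}) = j + 1.
mainTheorem4 : (r k : ℕ) → 2 ≤ r → 1 ≤ k → Σ ℕ (λ n → ChromaticNumber≡ (HH n r) k)
mainTheorem4 zero          _       ()         _
mainTheorem4 (suc zero)    _       (s≤s ())   _
mainTheorem4 (suc (suc _)) zero    _          ()
mainTheorem4 r@(suc (suc t)) (suc j) 2≤r _ =
  let (n , colourable , not-colourable) =
        threshold (λ n → HH-colourable? n r j) (HH₀-colourable r j)
                  (suc (2 ^ 2 ^ j) * suc t) (Embedding.HH-not-colourable t (n<1+n _))
  in suc n , growth 2≤r colourable , λ i i<k → not-colourable ∘ colourable-mono (s≤s⁻¹ i<k)
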